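{- For every $\kappa\geq 1$ and $\delta\geq 1$, the incremental algorithm $\mathcal{A}$ (described in the context) guarantees, at every time, for every node $x$ with $d_{G_0}(x,s)\leq X$: $$d_G(x,s)\leq d_{G_0}(x,s)\leq d_G(x,s)+\kappa\delta .$$
   Context: Let $G$ be an unweighted undirected graph on a fixed node set $V$ with root $s$, initially connected, undergoing edge insertions; $G$ denotes the current graph. Algorithm $\mathcal{A}$ has parameters $\kappa,\delta,X$ and works in phases. At the start of each phase (and initially) it lets $G_0$ denote the current graph, computes a BFS tree of $G_0$ rooted at $s$ up to depth $X$ together with the distances $d_{G_0}(\cdot,s)$, and resets a counter $k$ to $0$. When an edge $(u,v)$ is inserted (with endpoints named so that $d_{G_0}(u,s)\geq d_{G_0}(v,s)$), it increments $k$; if $k$ reaches $\kappa$ it starts a new phase; and if $d_{G_0}(u,s)>d_{G_0}(v,s)+\delta$ it starts a new phase. Thus $G_0$ always denotes the graph at the beginning of the current phase. -}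

module Defs where

open import Data.Nat using (ℕ; zero; suc; _+_; _*_; _≤_; _<_)
open import Data.Fin using (Fin)
open import Data.Product using (_×_; _,_; ∃)
open import Data.Sum using (_⊎_)
open import Data.List using (List; []; _∷_)
open import Data.List.Membership.Propositional using (_∈_)
open import Relation.Binary.PropositionalEquality using (_≡_; _≢_)
open import Relation.Nullary using (¬_)

-- Node set V = Fin n.  An (undirected, unweighted) graph is a finite list of edges;
-- an edge (a , b) joins a and b in both directions.  Inserting an edge = consing it.
Edge : ℕ → Set
Edge n = Fin n × Fin n

Graph : ℕ → Set
Graph n = List (Edge n)

Adj : ∀ {n} → Graph n → Fin n → Fin n → Set
Adj G x y = ((x , y) ∈ G) ⊎ ((y , x) ∈ G)

data Walk {n} (G : Graph n) : Fin n → Fin n → ℕ → Set where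
  nil  : ∀ x → Walk G x x 0
  cons : ∀ {x y z ℓ} → Adj G x y → Walk G y z ℓ → Walk G x z (suc ℓ)

Connected : ∀ {n} → Graph n → Set
Connected G = ∀ x y → ∃ λ ℓ → Walk G x y ℓ

IsDist : ∀ {n} → Graph n → Fin n → Fin n → ℕ → Set
IsDist G x y d = Walk G x y d × (∀ m → Walk G x y m → d ≤ m)

-- For an inserted edge with endpoint distances du, dv (in G₀), after naming the
-- endpoints so that the first is the farther one, the test d(u,s) > d(v,s) + δ.
Violates : ℕ → ℕ → ℕ → Set
Violates δ da db = (db + δ < da) ⊎ (da + δ < db)

-- Run κ δ s G₁ es G G₀ k : after starting from the initial graph G₁ and inserting the
-- edges es (most recent first), algorithm 𝒜 is in the state where the current graph
-- is G, the graph at the beginning of the current phase is G₀, and the counter is k.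
data Run {n} (κ δ : ℕ) (s : Fin n) (G₁ : Graph n)
     : List (Edge n) → Graph n → Graph n → ℕ → Set where
  init : Run κ δ s G₁ [] G₁ G₁ 0
  step-count : ∀ {es G G₀ k a b} → Run κ δ s G₁ es G G₀ k →
    suc k ≡ κ →
    Run κ δ s G₁ ((a , b) ∷ es) ((a , b) ∷ G) ((a , b) ∷ G) 0
  step-viol : ∀ {es G G₀ k a b da db} → Run κ δ s G₁ es G G₀ k →
    IsDist G₀ a s da → IsDist G₀ b s db → Violates δ da db →
    Run κ δ s G₁ ((a , b) ∷ es) ((a , b) ∷ G) ((a , b) ∷ G) 0
  step-cont : ∀ {es G G₀ k a b da db} → Run κ δ s G₁ es G G₀ k →
    suc k ≢ κ →
    IsDist G₀ a s da → IsDist G₀ b s db → ¬ Violates δ da db →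
    Run κ δ s G₁ ((a , b) ∷ es) ((a , b) ∷ G) G₀ (suc k)

module Submission where

-- Within a phase that started with graph G₀, the current graph is
-- G = E ++ G₀, where E lists the k < κ edges inserted so far in the phase.  Every
-- such edge (a , b) passed the distance test, so its endpoints are "δ-close":
-- a walk from either endpoint to s in G₀ yields one from the other endpoint at
-- most δ longer.  The lower bound d_G ≤ d_{G₀} is immediate since G₀ ⊆ G.  For the
-- upper bound we reroute a walk W to s in E ++ G₀ into G₀: at the first edge
-- e ∈ E used by W we jump to the part of W after its LAST use of e.  That part
-- starts at an endpoint of e, avoids e, hence lives in (E minus e) ++ G₀ and can be
-- rerouted recursively; closeness of the endpoints of e costs δ.  Each edge of E
-- is eliminated at most once, so the total detour is at most |E|·δ < κ·δ.

open import Defs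
open import Data.Nat using (ℕ; zero; suc; _+_; _*_; _≤_; _<_; z≤n; s≤s)
open import Data.Fin using (Fin)
open import Data.Product using (_×_; ∃; ∃₂; _,_; proj₁)
open import Data.List using (List; []; _∷_; _++_; length)
open import Data.Nat.Properties
open import Data.Fin.Properties using () renaming (_≟_ to _≟ᶠ_)
open import Data.Product.Properties using (≡-dec)
open import Data.Sum using (_⊎_; inj₁; inj₂)
open import Data.List.Properties using (length-removeAt′)
open import Data.List.Relation.Unary.All as All using (All; [])
open import Data.List.Relation.Unary.All.Properties using (─⁺)
open import Data.List.Relation.Unary.Any using (here; there; index; _─_)
open import Data.List.Membership.Propositional using (_∈_)
open import Data.List.Membership.Propositional.Properties using (∈-++⁺ˡ; ∈-++⁺ʳ; ∈-++⁻)
open import Data.Empty using (⊥-elim)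
open import Function using (_∘_)
open import Relation.Binary.Definitions using (DecidableEquality)
open import Relation.Binary.PropositionalEquality using (_≡_; _≢_; refl; sym; trans; cong)
open import Relation.Nullary using (¬_; yes; no)

private
  variable
    n : ℕ

Within : Graph n → Fin n → Fin n → ℕ → Set
Within G t y b = ∃ λ m → m ≤ b × Walk G y t m

within-weaken : ∀ {G : Graph n} {t y b b'} → b ≤ b' → Within G t y b → Within G t y b'
within-weaken b≤b' (m , m≤b , w) = m , ≤-trans m≤b b≤b' , w

within-step : ∀ {G : Graph n} {t x y b} → Adj G x y → Within G t y b → Within G t x (suc b)
within-step adj (m , m≤b , w) = suc m , s≤s m≤b , cons adj w

within-dist : ∀ {G : Graph n} {t x d b} → IsDist G x t d → Within G t x b → d ≤ b
within-dist (_ , minimal) (m , m≤b , w) = ≤-trans (minimal m w) m≤b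

Close : Graph n → Fin n → ℕ → Fin n → Fin n → Set
Close G t δ a b = ∀ m → Walk G b t m → Within G t a (m + δ)

close-refl : ∀ {G : Graph n} {t δ a} → Close G t δ a a
close-refl {δ = δ} m w = m , m≤m+n m δ , w

close-within : ∀ {G : Graph n} {t δ a b k} → Close G t δ a b → Within G t b k → Within G t a (k + δ)
close-within {δ = δ} close (m , m≤k , w) = within-weaken (+-monoˡ-≤ δ m≤k) (close m w)

close-of-dists : ∀ {G : Graph n} {t δ a b da db} →
  IsDist G a t da → IsDist G b t db → da ≤ db + δ → Close G t δ a b
close-of-dists {δ = δ} (walk-a , _) (_ , minimal-b) da≤db+δ m w =
  _ , ≤-trans da≤db+δ (+-monoˡ-≤ δ (minimal-b m w)) , walk-a

Tame : Graph n → Fin n → ℕ → Edge n → Set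
Tame G t δ (a , b) = Close G t δ a b × Close G t δ b a

Endpoint : Edge n → Fin n → Set
Endpoint (a , b) c = c ≡ a ⊎ c ≡ b

tame-endpoints : ∀ {G : Graph n} {t δ} (e : Edge n) → Tame G t δ e →
  ∀ {c c'} → Endpoint e c → Endpoint e c' → Close G t δ c c'
tame-endpoints _ _        (inj₁ refl) (inj₁ refl) = close-refl
tame-endpoints _ (ab , _) (inj₁ refl) (inj₂ refl) = ab
tame-endpoints _ (_ , ba) (inj₂ refl) (inj₁ refl) = ba
tame-endpoints _ _        (inj₂ refl) (inj₂ refl) = close-refl

admissible-tame : ∀ {G : Graph n} {t δ a b da db} →
  IsDist G a t da → IsDist G b t db → ¬ Violates δ da db → Tame G t δ (a , b)
admissible-tame dist-a dist-b ok =
  close-of-dists dist-a dist-b (≮⇒≥ (ok ∘ inj₁)) ,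
  close-of-dists dist-b dist-a (≮⇒≥ (ok ∘ inj₂))

walk-mono : ∀ {G H : Graph n} → (∀ {f} → f ∈ G → f ∈ H) →
  ∀ {x y ℓ} → Walk G x y ℓ → Walk H x y ℓ
walk-mono G⊆H (nil x)            = nil x
walk-mono G⊆H (cons (inj₁ xy) w) = cons (inj₁ (G⊆H xy)) (walk-mono G⊆H w)
walk-mono G⊆H (cons (inj₂ yx) w) = cons (inj₂ (G⊆H yx)) (walk-mono G⊆H w)

_≟ₑ_ : DecidableEquality (Edge n)
_≟ₑ_ = ≡-dec _≟ᶠ_ _≟ᶠ_

Keeps : Graph n → Edge n → Graph n → Set
Keeps H e H' = ∀ {f} → f ∈ H → f ≢ e → f ∈ H'

step-in : ∀ {H H' : Graph n} (e : Edge n) → Keeps H e H' →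
  ∀ {x y} → Adj H x y → Adj H' x y ⊎ Endpoint e y
step-in e keep {x} {y} (inj₁ xy) with (x , y) ≟ₑ e
... | yes refl = inj₂ (inj₂ refl)
... | no xy≢e  = inj₁ (inj₁ (keep xy xy≢e))
step-in e keep {x} {y} (inj₂ yx) with (y , x) ≟ₑ e
... | yes refl = inj₂ (inj₁ refl)
... | no yx≢e  = inj₁ (inj₂ (keep yx yx≢e))

ExitWalk : Graph n → Fin n → Edge n → ℕ → Set
ExitWalk H t e ℓ = ∃₂ λ c ℓ' → Endpoint e c × ℓ' ≤ ℓ × Walk H c t ℓ'

last-exit : ∀ {H H' : Graph n} {t} (e : Edge n) → Keeps H e H' →
  ∀ {z ℓ} → Walk H z t ℓ → Walk H' z t ℓ ⊎ ExitWalk H' t e ℓ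
last-exit e keep (nil z) = inj₁ (nil z)
last-exit e keep (cons adj rest) with last-exit e keep rest
... | inj₂ (c , ℓ' , c∈e , ℓ'≤ℓ , w) = inj₂ (c , ℓ' , c∈e , m≤n⇒m≤1+n ℓ'≤ℓ , w)
... | inj₁ w with step-in e keep adj
...   | inj₁ adj' = inj₁ (cons adj' w)
...   | inj₂ y∈e  = inj₂ (_ , _ , y∈e , n≤1+n _ , w)

∈-─⁺ : ∀ {A : Set} {e f : A} {E : List A} (p : e ∈ E) → f ∈ E → f ≢ e → f ∈ (E ─ p)
∈-─⁺ (here refl) (here refl) f≢e = ⊥-elim (f≢e refl)
∈-─⁺ (here refl) (there f∈E) _   = f∈E
∈-─⁺ (there p)   (here f≡x)  _   = here f≡x
∈-─⁺ (there p)   (there f∈E) f≢e = there (∈-─⁺ p f∈E f≢e)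

removal-keeps : ∀ {G₀ : Graph n} {e} (E : List (Edge n)) (p : e ∈ E) → Keeps (E ++ G₀) e ((E ─ p) ++ G₀)
removal-keeps E p f∈ f≢e with ∈-++⁻ E f∈
... | inj₁ f∈E  = ∈-++⁺ˡ (∈-─⁺ p f∈E f≢e)
... | inj₂ f∈G₀ = ∈-++⁺ʳ (E ─ p) f∈G₀

step-split : ∀ {G₀ : Graph n} (E : List (Edge n)) → ∀ {y y'} → Adj (E ++ G₀) y y' →
  Adj G₀ y y' ⊎ ∃ λ e → e ∈ E × Endpoint e y × Endpoint e y'
step-split E (inj₁ yy') with ∈-++⁻ E yy'
... | inj₁ ∈E  = inj₂ (_ , ∈E , inj₁ refl , inj₂ refl)
... | inj₂ ∈G₀ = inj₁ (inj₁ ∈G₀)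
step-split E (inj₂ y'y) with ∈-++⁻ E y'y
... | inj₁ ∈E  = inj₂ (_ , ∈E , inj₂ refl , inj₁ refl)
... | inj₂ ∈G₀ = inj₁ (inj₂ ∈G₀)

final-segment : ∀ {G₀ : Graph n} {t e} (E : List (Edge n)) (p : e ∈ E) →
  ∀ {y' ℓ} → Endpoint e y' → Walk (E ++ G₀) y' t ℓ → ExitWalk ((E ─ p) ++ G₀) t e ℓ
final-segment {e = e} E p y'∈e rest with last-exit e (removal-keeps E p) rest
... | inj₁ avoiding = _ , _ , y'∈e , ≤-refl , avoiding
... | inj₂ exit     = exit

detour-cost : ∀ {ℓ' ℓ r L δ} → ℓ' ≤ ℓ → L ≡ suc r → ℓ' + r * δ + δ ≤ suc ℓ + L * δ
detour-cost {ℓ'} {ℓ} {r} {L} {δ} ℓ'≤ℓ L≡1+r = begin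
  ℓ' + r * δ + δ    ≤⟨ +-monoˡ-≤ δ (+-monoˡ-≤ (r * δ) ℓ'≤ℓ) ⟩
  ℓ + r * δ + δ     ≡⟨ +-assoc ℓ (r * δ) δ ⟩
  ℓ + (r * δ + δ)   ≡⟨ cong (ℓ +_) (+-comm (r * δ) δ) ⟩
  ℓ + suc r * δ     ≡⟨ cong (λ j → ℓ + j * δ) (sym L≡1+r) ⟩
  ℓ + L * δ         ≤⟨ n≤1+n _ ⟩
  suc ℓ + L * δ     ∎
  where open ≤-Reasoning

-- The recursion is on the walk, and on N = |E| whenever an edge is eliminated.
module Rerouting (G₀ : Graph n) (t : Fin n) (δ : ℕ) where

  mutual
    reroute : ∀ N (E : List (Edge n)) → length E ≡ N → All (Tame G₀ t δ) E →
      ∀ {y ℓ} → Walk (E ++ G₀) y t ℓ → Within G₀ t y (ℓ + length E * δ)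
    reroute N E len tame (nil _) = 0 , z≤n , nil t
    reroute N E len tame (cons adj rest) with step-split E adj
    ... | inj₁ adj₀ = within-step adj₀ (reroute N E len tame rest)
    ... | inj₂ (e , p , y∈e , y'∈e) =
      detour N E len tame p y∈e (final-segment E p y'∈e rest)

    detour : ∀ N (E : List (Edge n)) → length E ≡ N → All (Tame G₀ t δ) E →
      ∀ {e y ℓ} (p : e ∈ E) → Endpoint e y → ExitWalk ((E ─ p) ++ G₀) t e ℓ →
      Within G₀ t y (suc ℓ + length E * δ)
    detour zero E len _ p _ _ =
      ⊥-elim (0≢1+n (trans (sym len) (length-removeAt′ E (index p))))
    detour (suc N) E len tame {e} p y∈e (c , ℓ' , c∈e , ℓ'≤ℓ , w) =
      within-weaken (detour-cost ℓ'≤ℓ (length-removeAt′ E (index p)))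
        (close-within (tame-endpoints e (All.lookup tame p) y∈e c∈e)
          (reroute N (E ─ p) len-─ (─⁺ p tame) w))
      where
      len-─ : length (E ─ p) ≡ N
      len-─ = suc-injective (trans (sym (length-removeAt′ E (index p))) len)

open Rerouting using (reroute)

record PhaseInvariant (κ δ : ℕ) (s : Fin n) (G G₀ : Graph n) (k : ℕ) : Set where
  constructor phase
  field
    inserted : List (Edge n)
    current  : G ≡ inserted ++ G₀
    counted  : length inserted ≡ k
    tame     : All (Tame G₀ s δ) inserted
    below-κ  : k < κ

phase-invariant : ∀ {κ δ : ℕ} {s : Fin n} {G₁ es G G₀ k} → 1 ≤ κ →
  Run κ δ s G₁ es G G₀ k → PhaseInvariant κ δ s G G₀ k
phase-invariant 1≤κ init                   = phase [] refl refl [] 1≤κ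
phase-invariant 1≤κ (step-count _ _)       = phase [] refl refl [] 1≤κ
phase-invariant 1≤κ (step-viol _ _ _ _)    = phase [] refl refl [] 1≤κ
phase-invariant 1≤κ (step-cont r 1+k≢κ dist-a dist-b ok)
  with phase-invariant 1≤κ r
... | phase E refl refl tame k<κ =
  phase (_ ∷ E) refl refl (admissible-tame dist-a dist-b ok All.∷ tame) (≤∧≢⇒< k<κ 1+k≢κ)

lemma1 : ∀ {n} (κ δ X : ℕ) (s : Fin n) → 1 ≤ κ → 1 ≤ δ →
    (G₁ : Graph n) → Connected G₁ →
    ∀ (es : List (Edge n)) (G G₀ : Graph n) (k : ℕ) → Run κ δ s G₁ es G G₀ k →
    ∀ (x : Fin n) (d₀ d : ℕ) → IsDist G₀ x s d₀ → d₀ ≤ X → IsDist G x s d →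
    (d ≤ d₀) × (d₀ ≤ d + κ * δ)
lemma1 κ δ _ s 1≤κ _ _ _ _ _ G₀ _ run _ d₀ d dist₀ _ (walk , minimal)
  with phase-invariant 1≤κ run
... | phase E refl refl tame k<κ = d≤d₀ , d₀≤d+κδ
  where
  d≤d₀ : d ≤ d₀
  d≤d₀ = minimal d₀ (walk-mono (∈-++⁺ʳ E) (proj₁ dist₀))
  d₀≤d+κδ : d₀ ≤ d + κ * δ
  d₀≤d+κδ = ≤-trans (within-dist dist₀ (reroute G₀ s δ (length E) E refl tame walk))
                    (+-monoʳ-≤ d (*-monoˡ-≤ δ (<⇒≤ k<κ)))
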